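{- Let $A$ be a finite ordered set, $D$ a positive integer, and $\rho:A^{(D)}\to\mathbb{R}$. Define $\pi:A^{(2D)}\to\mathbb{R}$ by $$\pi(a)=\sum_{a_1\leq\alpha_1<a_2}\ \sum_{a_3\leq\alpha_2<a_4}\cdots\sum_{a_{2D-1}\leq\alpha_D<a_{2D}}\rho(\alpha_1,\dots,\alpha_D),$$ where the $\alpha_i$ range over elements of $A$. Then there exists $\phi:A^{(D)}\to\mathbb{R}$ such that $\psi_\phi(a)=\pi(a)$ for all $a\in A^{(2D)}$.
   Context: For an ordered set $A$, $A^{(k)}=\{(a_1,\dots,a_k)\in A^k:a_1<\dots<a_k\}$. For $\phi:A^{(D)}\to\mathbb{R}$, its hypercubic evaluation $\psi_\phi:A^{(2D)}\to\mathbb{R}$ is $$\psi_\phi(a)=\sum_{\varepsilon\in\{0,1\}^D}(-1)^{\varepsilon_1+\dots+\varepsilon_D}\,\phi\big((a_{2i-\varepsilon_i})_{i=1,\dots,D}\big).$$ -}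

module Defs where

open import Level using (Level)
open import Data.Nat as ℕ using (ℕ; zero; suc; _+_; _≤ᵇ_; _<ᵇ_)
open import Data.Bool using (Bool; true; false; if_then_else_; _∧_)
open import Data.Fin as Fin using (Fin; combine; toℕ)
open import Data.List using (List; []; _∷_; [_]; map; concatMap; foldr; allFin)
open import Data.Vec.Functional using (Vector) renaming (_∷_ to _∷ᶠ_)
open import Algebra.Bundles using (AbelianGroup)

-- The finite ordered set A is modelled as Fin n with its usual order.
-- A k-tuple of elements of A is a function Fin k → Fin n (0-based indices).

-- a ∈ A^(k): strictly increasing tuples.
Increasing : ∀ {n k} → (Fin k → Fin n) → Set
Increasing {n} {k} a = ∀ (i j : Fin k) → i Fin.< j → a i Fin.< a j

allTuples : ∀ {X : Set} → List X → (D : ℕ) → List (Fin D → X)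
allTuples xs zero    = [ (λ ()) ]
allTuples xs (suc d) = concatMap (λ x → map (x ∷ᶠ_) (allTuples xs d)) xs

ones : ∀ {D} → (Fin D → Bool) → ℕ
ones {zero}  e = 0
ones {suc d} e = (if e Fin.zero then 1 else 0) + ones (λ i → e (Fin.suc i))

-- 0-based: position 2i is a_{2i+1} (1-based a_{2(i+1)-1}), position 2i+1 is a_{2(i+1)}
lowIx highIx : ∀ {D} → Fin D → Fin (D ℕ.* 2)
lowIx  i = combine i Fin.zero
highIx i = combine i (Fin.suc Fin.zero)

inBox : ∀ {n D} → (Fin (D ℕ.* 2) → Fin n) → (Fin D → Fin n) → Bool
inBox {n} {D} a α =
  foldr _∧_ true
    (map (λ i → (toℕ (a (lowIx i)) ≤ᵇ toℕ (α i)) ∧ (toℕ (α i) <ᵇ toℕ (a (highIx i))))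
         (allFin D))

module _ {c ℓ : Level} (G : AbelianGroup c ℓ) where
  open AbelianGroup G

  gsum : List Carrier → Carrier
  gsum = foldr _∙_ ε

  signPow : ℕ → Carrier → Carrier
  signPow zero    x = x
  signPow (suc k) x = (signPow k x) ⁻¹

  -- hypercubic evaluation ψ_φ(a) = Σ_ε (-1)^{|ε|} φ((a_{2i-ε_i})_i)
  hypercubic : ∀ {n D} → ((Fin D → Fin n) → Carrier) → (Fin (D ℕ.* 2) → Fin n) → Carrier
  hypercubic {n} {D} φ a =
    gsum (map (λ e → signPow (ones e)
                       (φ (λ i → a (if e i then lowIx i else highIx i))))
              (allTuples (false ∷ true ∷ []) D))

  boxSum : ∀ {n D} → ((Fin D → Fin n) → Carrier) → (Fin (D ℕ.* 2) → Fin n) → Carrier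
  boxSum {n} {D} ρ a =
    gsum (map (λ α → if inBox a α then ρ α else ε) (allTuples (allFin n) D))

-- Take φ(β) to be the sum of ρ(α) over all α lying strictly below β in every
-- coordinate. For a fixed α, the coefficient of ρ(α) in ψ_φ(a) is an alternating
-- sum over the 2^D corners of the box [a₁,a₂) × ⋯ × [a_{2D-1},a_{2D}); it factors
-- coordinatewise as ∏ᵢ ([αᵢ < a_{2i}] − [αᵢ < a_{2i-1}]) = ∏ᵢ [a_{2i-1} ≤ αᵢ < a_{2i}],
-- which is exactly the coefficient of ρ(α) in π(a).
module Submission where

open import Defs
open import Data.Nat using (ℕ; _≤_; _*_; zero; suc; _<ᵇ_; _≤ᵇ_; z<s)
open import Data.Fin as Fin using (Fin; toℕ)
open import Data.Product using (Σ-syntax; _,_)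
open import Algebra.Bundles using (AbelianGroup)

open import Level using (Level)
open import Data.Nat.Properties using (<ᵇ⇒<; <⇒<ᵇ; <-trans; +-monoʳ-<)
open import Data.Fin.Properties using (toℕ-combine)
open import Data.Bool using (Bool; true; false; if_then_else_; _∧_; not; T)
open import Data.Bool.Properties using (∧-comm)
open import Data.List using (List; []; _∷_; map; tabulate; _++_; concatMap; allFin)
open import Data.Bool.ListAction using (and)
open import Data.List.Properties using (map-∘; map-tabulate; map-cong)
open import Data.Vec.Functional using () renaming (_∷_ to _∷ᶠ_)
open import Function using (_∘_)
open import Relation.Binary.PropositionalEquality as ≡ using (_≡_)
import Algebra.Properties.AbelianGroup as AbelianGroupProperties
import Algebra.Properties.Group as GroupProperties
import Algebra.Properties.CommutativeSemigroup as CommutativeSemigroupProperties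
import Relation.Binary.Reasoning.Setoid as SetoidReasoning

allᵇ : ∀ {D} → (Fin D → Bool) → Bool
allᵇ P = and (tabulate P)

allᵇ-cong : ∀ {D} {P Q : Fin D → Bool} → (∀ i → P i ≡ Q i) → allᵇ P ≡ allᵇ Q
allᵇ-cong {zero}  eq = ≡.refl
allᵇ-cong {suc D} eq = ≡.cong₂ _∧_ (eq Fin.zero) (allᵇ-cong (eq ∘ Fin.suc))

not-<ᵇ : ∀ m n → not (m <ᵇ n) ≡ (n ≤ᵇ m)
not-<ᵇ _       zero          = ≡.refl
not-<ᵇ zero    (suc _)       = ≡.refl
not-<ᵇ (suc _) (suc zero)    = ≡.refl
not-<ᵇ (suc m) (suc (suc n)) = not-<ᵇ m (suc n)

lowIx<highIx : ∀ {D} (i : Fin D) → lowIx i Fin.< highIx i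
lowIx<highIx i rewrite toℕ-combine i (Fin.zero {1}) | toℕ-combine i (Fin.suc (Fin.zero {0})) =
  +-monoʳ-< (2 * toℕ i) z<s

inBox≡allᵇ : ∀ {n D} (a : Fin (D * 2) → Fin n) (α : Fin D → Fin n) →
  inBox a α ≡ allᵇ (λ i → (toℕ (a (lowIx i)) ≤ᵇ toℕ (α i)) ∧ (toℕ (α i) <ᵇ toℕ (a (highIx i))))
inBox≡allᵇ a α = ≡.cong and (map-tabulate (λ i → i)
  (λ i → (toℕ (a (lowIx i)) ≤ᵇ toℕ (α i)) ∧ (toℕ (α i) <ᵇ toℕ (a (highIx i)))))

module _ {c ℓ : Level} (G : AbelianGroup c ℓ) where
  open AbelianGroup G
  open GroupProperties group using (ε⁻¹≈ε)
  open AbelianGroupProperties G using (⁻¹-∙-comm)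
  open CommutativeSemigroupProperties commutativeSemigroup using (interchange)
  open SetoidReasoning setoid

  ∑ : ∀ {X : Set} → List X → (X → Carrier) → Carrier
  ∑ xs f = gsum G (map f xs)

  syntax ∑ xs (λ x → t) = ∑[ x ∈ xs ] t

  ∑-cong : ∀ {X : Set} (xs : List X) {f g : X → Carrier} → (∀ x → f x ≈ g x) → ∑ xs f ≈ ∑ xs g
  ∑-cong []       eq = refl
  ∑-cong (x ∷ xs) eq = ∙-cong (eq x) (∑-cong xs eq)

  ∑-ε : ∀ {X : Set} (xs : List X) → ∑[ x ∈ xs ] ε ≈ ε
  ∑-ε []       = refl
  ∑-ε (x ∷ xs) = trans (∙-congˡ (∑-ε xs)) (identityʳ ε)

  ∑-∙ : ∀ {X : Set} (xs : List X) (f g : X → Carrier) → ∑[ x ∈ xs ] (f x ∙ g x) ≈ ∑ xs f ∙ ∑ xs g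
  ∑-∙ []       f g = sym (identityʳ ε)
  ∑-∙ (x ∷ xs) f g = trans (∙-congˡ (∑-∙ xs f g)) (interchange (f x) (g x) (∑ xs f) (∑ xs g))

  ∑-⁻¹ : ∀ {X : Set} (xs : List X) (f : X → Carrier) → ∑[ x ∈ xs ] (f x ⁻¹) ≈ (∑ xs f) ⁻¹
  ∑-⁻¹ []       f = sym ε⁻¹≈ε
  ∑-⁻¹ (x ∷ xs) f = trans (∙-congˡ (∑-⁻¹ xs f)) (⁻¹-∙-comm (f x) (∑ xs f))

  ∑-comm : ∀ {X Y : Set} (xs : List X) (ys : List Y) (f : X → Y → Carrier) →
    ∑[ x ∈ xs ] ∑[ y ∈ ys ] f x y ≈ ∑[ y ∈ ys ] ∑[ x ∈ xs ] f x y
  ∑-comm []       ys f = sym (∑-ε ys)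
  ∑-comm (x ∷ xs) ys f =
    trans (∙-congˡ (∑-comm xs ys f)) (sym (∑-∙ ys (f x) (λ y → ∑[ x ∈ xs ] f x y)))

  ∑-++ : ∀ {X : Set} (xs ys : List X) (f : X → Carrier) → ∑ (xs ++ ys) f ≈ ∑ xs f ∙ ∑ ys f
  ∑-++ []       ys f = sym (identityˡ _)
  ∑-++ (x ∷ xs) ys f = trans (∙-congˡ (∑-++ xs ys f)) (sym (assoc _ _ _))

  ∑-map : ∀ {X Y : Set} (h : X → Y) (xs : List X) (f : Y → Carrier) → ∑ (map h xs) f ≡ ∑ xs (f ∘ h)
  ∑-map h xs f = ≡.cong (gsum G) (≡.sym (map-∘ xs))

  ∑-concatMap : ∀ {X Y : Set} (g : X → List Y) (xs : List X) (f : Y → Carrier) →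
    ∑ (concatMap g xs) f ≈ ∑[ x ∈ xs ] ∑ (g x) f
  ∑-concatMap g []       f = refl
  ∑-concatMap g (x ∷ xs) f = trans (∑-++ (g x) (concatMap g xs) f) (∙-congˡ (∑-concatMap g xs f))

  ∑-allTuples-suc : ∀ {X : Set} (xs : List X) (d : ℕ) (f : (Fin (suc d) → X) → Carrier) →
    ∑ (allTuples xs (suc d)) f ≈ ∑[ x ∈ xs ] ∑[ t ∈ allTuples xs d ] f (x ∷ᶠ t)
  ∑-allTuples-suc xs d f = trans (∑-concatMap _ xs f)
    (∑-cong xs (λ x → reflexive (∑-map (x ∷ᶠ_) (allTuples xs d) f)))

  signPow-∑ : ∀ {X : Set} k (xs : List X) (f : X → Carrier) →
    signPow G k (∑ xs f) ≈ ∑[ x ∈ xs ] signPow G k (f x)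
  signPow-∑ zero    xs f = refl
  signPow-∑ (suc k) xs f = trans (⁻¹-cong (signPow-∑ k xs f)) (sym (∑-⁻¹ xs (signPow G k ∘ f)))

  [_]·_ : Bool → Carrier → Carrier
  [ b ]· x = if b then x else ε

  []·-cong : ∀ b {x y} → x ≈ y → [ b ]· x ≈ [ b ]· y
  []·-cong false eq = refl
  []·-cong true  eq = eq

  []·-∧ : ∀ p b x → [ p ∧ b ]· x ≡ [ b ]· ([ p ]· x)
  []·-∧ false false x = ≡.refl
  []·-∧ false true  x = ≡.refl
  []·-∧ true  b     x = ≡.refl

  []·-∙⁻¹ : ∀ b x y → [ b ]· x ∙ ([ b ]· y) ⁻¹ ≈ [ b ]· (x ∙ y ⁻¹)
  []·-∙⁻¹ false x y = trans (∙-congˡ ε⁻¹≈ε) (identityʳ ε)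
  []·-∙⁻¹ true  x y = refl

  []·-difference : ∀ p q x → (T q → T p) → [ p ]· x ∙ ([ q ]· x) ⁻¹ ≈ [ p ∧ not q ]· x
  []·-difference true  true  x q⇒p = inverseʳ x
  []·-difference true  false x q⇒p = trans (∙-congˡ ε⁻¹≈ε) (identityʳ x)
  []·-difference false true  x q⇒p with () ← q⇒p _
  []·-difference false false x q⇒p = trans (∙-congˡ ε⁻¹≈ε) (identityʳ ε)

  cube : (D : ℕ) → List (Fin D → Bool)
  cube D = allTuples (false ∷ true ∷ []) D

  ∑-cube-suc : ∀ d (f : (Fin (suc d) → Bool) → Carrier) →
    ∑ (cube (suc d)) f ≈ ∑[ e ∈ cube d ] f (false ∷ᶠ e) ∙ ∑[ e ∈ cube d ] f (true ∷ᶠ e)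
  ∑-cube-suc d f = trans (∑-allTuples-suc (false ∷ true ∷ []) d f) (∙-congˡ (identityʳ _))

  -- The alternating sum factors as ∏ᵢ ([Pᵢ(0)] − [Pᵢ(1)]), and each factor is an
  -- indicator because Pᵢ is decreasing.
  alternating-∑-cube : ∀ D (P : Fin D → Bool → Bool) → (∀ i → T (P i true) → T (P i false)) →
    ∀ x → ∑[ e ∈ cube D ] signPow G (ones e) ([ allᵇ (λ i → P i (e i)) ]· x)
            ≈ [ allᵇ (λ i → P i false ∧ not (P i true)) ]· x
  alternating-∑-cube zero    P P-mono x = identityʳ x
  alternating-∑-cube (suc d) P P-mono x = begin
    ∑[ e ∈ cube (suc d) ] signPow G (ones e) ([ allᵇ (λ i → P i (e i)) ]· x)
      ≈⟨ ∑-cube-suc d _ ⟩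
    ∑[ e ∈ cube d ] signPow G (ones e) ([ p ∧ B e ]· x)
      ∙ ∑[ e ∈ cube d ] (signPow G (ones e) ([ q ∧ B e ]· x) ⁻¹)
      ≡⟨ ≡.cong₂ _∙_ (indicator-inward (λ y → y) p) (indicator-inward _⁻¹ q) ⟩
    ∑[ e ∈ cube d ] signPow G (ones e) ([ B e ]· ([ p ]· x))
      ∙ ∑[ e ∈ cube d ] (signPow G (ones e) ([ B e ]· ([ q ]· x)) ⁻¹)
      ≈⟨ ∙-congˡ (∑-⁻¹ (cube d) _) ⟩
    ∑[ e ∈ cube d ] signPow G (ones e) ([ B e ]· ([ p ]· x))
      ∙ (∑[ e ∈ cube d ] signPow G (ones e) ([ B e ]· ([ q ]· x))) ⁻¹
      ≈⟨ ∙-cong (alternating-∑-cube d P′ (P-mono ∘ Fin.suc) ([ p ]· x))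
                (⁻¹-cong (alternating-∑-cube d P′ (P-mono ∘ Fin.suc) ([ q ]· x))) ⟩
    [ B′ ]· ([ p ]· x) ∙ ([ B′ ]· ([ q ]· x)) ⁻¹
      ≈⟨ []·-∙⁻¹ B′ _ _ ⟩
    [ B′ ]· ([ p ]· x ∙ ([ q ]· x) ⁻¹)
      ≈⟨ []·-cong B′ ([]·-difference p q x (P-mono Fin.zero)) ⟩
    [ B′ ]· ([ p ∧ not q ]· x)
      ≡⟨ ≡.sym ([]·-∧ (p ∧ not q) B′ x) ⟩
    [ allᵇ (λ i → P i false ∧ not (P i true)) ]· x ∎
    where
    p q B′ : Bool
    p = P Fin.zero false
    q = P Fin.zero true
    P′ : Fin d → Bool → Bool
    P′ = P ∘ Fin.suc
    B : (Fin d → Bool) → Bool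
    B e = allᵇ (λ i → P′ i (e i))
    B′ = allᵇ (λ i → P′ i false ∧ not (P′ i true))
    indicator-inward : ∀ (h : Carrier → Carrier) b →
      ∑[ e ∈ cube d ] h (signPow G (ones e) ([ b ∧ B e ]· x))
        ≡ ∑[ e ∈ cube d ] h (signPow G (ones e) ([ B e ]· ([ b ]· x)))
    indicator-inward h b =
      ≡.cong (gsum G) (map-cong (λ e → ≡.cong (h ∘ signPow G (ones e)) ([]·-∧ b (B e) x)) (cube d))

  lowerOrthantSum : ∀ {n D} → ((Fin D → Fin n) → Carrier) → (Fin D → Fin n) → Carrier
  lowerOrthantSum {n} {D} ρ β = ∑[ α ∈ allTuples (allFin n) D ] [ allᵇ (λ i → toℕ (α i) <ᵇ toℕ (β i)) ]· ρ α

  hypercubic-lowerOrthantSum : ∀ {n D} (ρ : (Fin D → Fin n) → Carrier) (a : Fin (D * 2) → Fin n) →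
    Increasing a → hypercubic G (lowerOrthantSum ρ) a ≈ boxSum G ρ a
  hypercubic-lowerOrthantSum {n} {D} ρ a a-inc = begin
    hypercubic G (lowerOrthantSum ρ) a
      ≈⟨ ∑-cong (cube D) (λ e → signPow-∑ (ones e) αs _) ⟩
    ∑[ e ∈ cube D ] ∑[ α ∈ αs ] signPow G (ones e) ([ allᵇ (λ i → below α i (e i)) ]· ρ α)
      ≈⟨ ∑-comm (cube D) αs _ ⟩
    ∑[ α ∈ αs ] ∑[ e ∈ cube D ] signPow G (ones e) ([ allᵇ (λ i → below α i (e i)) ]· ρ α)
      ≈⟨ ∑-cong αs (λ α → alternating-∑-cube D (below α) (below-mono α) (ρ α)) ⟩
    ∑[ α ∈ αs ] [ allᵇ (λ i → below α i false ∧ not (below α i true)) ]· ρ α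
      ≡⟨ ≡.cong (gsum G) (map-cong (λ α → ≡.cong ([_]· ρ α) (inBox≡box α)) αs) ⟩
    boxSum G ρ a ∎
    where
    αs = allTuples (allFin n) D
    corner : Fin D → Bool → ℕ
    corner i b = toℕ (a (if b then lowIx i else highIx i))
    below : (Fin D → Fin n) → Fin D → Bool → Bool
    below α i b = toℕ (α i) <ᵇ corner i b
    below-mono : ∀ α i → T (below α i true) → T (below α i false)
    below-mono α i α<low = <⇒<ᵇ (<-trans (<ᵇ⇒< _ _ α<low) (a-inc _ _ (lowIx<highIx i)))
    inBox≡box : ∀ α → allᵇ (λ i → below α i false ∧ not (below α i true)) ≡ inBox a α
    inBox≡box α = ≡.trans (allᵇ-cong (λ i →
        ≡.trans (≡.cong (below α i false ∧_) (not-<ᵇ (toℕ (α i)) (corner i true)))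
                (∧-comm (below α i false) (corner i true ≤ᵇ toℕ (α i)))))
      (≡.sym (inBox≡allᵇ a α))

lemma5p1 : ∀ {c ℓ} (G : AbelianGroup c ℓ) (n D : ℕ) → 1 ≤ D
    → (ρ : (Fin D → Fin n) → AbelianGroup.Carrier G)
    → Σ[ φ ∈ ((Fin D → Fin n) → AbelianGroup.Carrier G) ]
    (∀ (a : Fin (D * 2) → Fin n) → Increasing a
    → AbelianGroup._≈_ G (hypercubic G φ a) (boxSum G ρ a))
lemma5p1 G n D _ ρ = lowerOrthantSum G ρ , hypercubic-lowerOrthantSum G ρ
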